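{- Let $(X,\mathcal{B})$ be a $(v,k,1)$-BIBD with replication number $r$, used as a distribution design for a combinatorial repairable threshold scheme, and let $P_i$ be any player in the scheme. Suppose every player other than $P_i$ is available independently with probability $p$. Then the expected number of available minimal repair sets for $P_i$ is \[E(p)=(r-1)^k p^k.\]
   Context: A $(v,k,1)$-BIBD ($2\le k<v$) is a set system $(X,\mathcal{B})$ with $|X|=v$, every block of size $k$, and every pair of distinct points contained in exactly one block. Every point then lies in exactly $r=(v-1)/(k-1)$ blocks; $r$ is the replication number. In a combinatorial repairable threshold scheme the blocks $B_1,\dots,B_n$ of the distribution design correspond to players $P_1,\dots,P_n$. A repair set for $P_i$ is a set $S$ of players other than $P_i$ whose blocks cover $B_i$, i.e. $B_i\subseteq\bigcup_{P_j\in S}B_j$. A repair set is minimal if no proper subset of it is a repair set. A repair set is available if every player in it is available. $E(p)$ denotes the expected number of available minimal repair sets for $P_i$.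
   Formalization: The availability probability p ranges over the rationals in [0,1]. -}

module Defs where

open import Data.Nat as ℕ using (ℕ; zero; suc; _∸_)
open import Data.Fin using (Fin)
open import Data.Fin.Subset using (Subset; _∈_; _∉_; _⊆_; _⊂_; ⋃; ∣_∣; inside; outside)
open import Data.Fin.Subset.Properties using (_∈?_; _⊆?_; _⊂?_; anySubset?)
open import Data.List using (List; []; _∷_; _++_; map)
open import Data.Vec using (_∷_; [])
open import Data.Product using (_×_; _,_; ∃; ∃!)
open import Data.Rational using (ℚ; 0ℚ; 1ℚ; _+_; _*_)
open import Relation.Binary.PropositionalEquality using (_≡_; _≢_)
open import Relation.Nullary using (Dec; yes; no; ¬_)
open import Relation.Nullary.Decidable using (_×-dec_; ¬?)

record IsBIBD (v k b : ℕ) (B : Fin b → Subset v) : Set where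
  field
    two≤k      : 2 ℕ.≤ k
    k<v        : k ℕ.< v
    blockSize  : ∀ j → ∣ B j ∣ ≡ k
    pairUnique : ∀ (x y : Fin v) → x ≢ y → ∃! _≡_ (λ j → x ∈ B j × y ∈ B j)

members : ∀ {n} → Subset n → List (Fin n)
members {zero}  []            = []
members {suc n} (outside ∷ S) = map Fin.suc (members S)
members {suc n} (inside  ∷ S) = Fin.zero ∷ map Fin.suc (members S)

coverOf : ∀ {v b} → (Fin b → Subset v) → Subset b → Subset v
coverOf B S = ⋃ (map B (members S))

IsRepairSet : ∀ {v b} → (Fin b → Subset v) → Fin b → Subset b → Set
IsRepairSet B i S = i ∉ S × B i ⊆ coverOf B S

IsMinimalRepairSet : ∀ {v b} → (Fin b → Subset v) → Fin b → Subset b → Set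
IsMinimalRepairSet B i S = IsRepairSet B i S × ¬ ∃ (λ T → T ⊂ S × IsRepairSet B i T)

isRepairSet? : ∀ {v b} (B : Fin b → Subset v) i S → Dec (IsRepairSet B i S)
isRepairSet? B i S = ¬? (i ∈? S) ×-dec (B i ⊆? coverOf B S)

isMinimalRepairSet? : ∀ {v b} (B : Fin b → Subset v) i S → Dec (IsMinimalRepairSet B i S)
isMinimalRepairSet? B i S =
  isRepairSet? B i S ×-dec ¬? (anySubset? (λ T → (T ⊂? S) ×-dec isRepairSet? B i T))

allSubsets : ∀ n → List (Subset n)
allSubsets zero    = [] ∷ []
allSubsets (suc n) = map (outside ∷_) (allSubsets n) ++ map (inside ∷_) (allSubsets n)

sumℚ : List ℚ → ℚ
sumℚ []       = 0ℚ
sumℚ (x ∷ xs) = x + sumℚ xs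

powℚ : ℚ → ℕ → ℚ
powℚ p zero    = 1ℚ
powℚ p (suc n) = p * powℚ p n

-- probability that all players of S are available (independent, each with prob. p)
availProb : ∀ {b} → ℚ → Subset b → ℚ
availProb p S = powℚ p ∣ S ∣

-- E(p): expected number of available minimal repair sets for player i
--      = Σ over minimal repair sets S of Pr[S available] (linearity of expectation)
expectedAvailMinRepair : ∀ {v b} → (Fin b → Subset v) → Fin b → ℚ → ℚ
expectedAvailMinRepair B i p = sumℚ (map term (allSubsets _))
  where
    term : Subset _ → ℚ
    term S with isMinimalRepairSet? B i S
    ... | yes _ = availProb p S
    ... | no  _ = 0ℚ

{-# OPTIONS --safe #-}

-- For j ≢ i the blocks B j and B i share at most one point, the contact point of player j. A set S
-- of players is a minimal repair set for player i exactly when S is a transversal of the contact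
-- map over B i: every point of B i is the contact point of exactly one player of S, and every
-- player of S has a contact point. Every point lies on r blocks, so each point of B i is the
-- contact point of r ∸ 1 players. Summing p ^ ∣ S ∣ over the transversals S of any partial map c
-- over any N gives ∏_{x ∈ N} (∣c⁻¹ x∣ · p), by induction on the number of players; for the
-- contact map this is ((r ∸ 1) · p) ^ k.
module Submission where

open import Defs
open import Data.Nat using (ℕ; _∸_)
open import Data.Fin using (Fin)
open import Data.Fin.Subset using (Subset)
open import Data.Rational using (ℚ; 0ℚ; 1ℚ; _≤_; _*_; _/_)
open import Data.Integer using (+_)
open import Relation.Binary.PropositionalEquality using (_≡_)

open import Level using (Level)
open import Function using (_∘_; _⇔_; mk⇔; module Equivalence; case_of_)
open import Function.Properties.Equivalence using () renaming (sym to ⇔-sym)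
open import Data.Empty using (⊥; ⊥-elim)
open import Data.Sum using (inj₁; inj₂)
open import Data.Product as Σ using (_×_; _,_; ∃-syntax; ∃!)
open import Data.Bool using (true; false; if_then_else_; _∧_)
open import Data.Maybe using (Maybe; just; nothing)
open import Data.Maybe.Properties using (just-injective; ≡-dec)
open import Data.List using ([]; _∷_; _++_; map)
open import Data.List.Properties using (map-++; map-∘; map-cong)
open import Data.Vec using (_∷_; []; here; there)
import Data.Nat as ℕ
import Data.Nat.Properties as ℕ
open import Data.Fin using (zero; suc; punchIn) renaming (_≟_ to _≟ᶠ_)
open import Data.Fin.Properties using (punchInᵢ≢i; suc-injective)
open import Data.Fin.Subset using (_∈_; _∉_; _⊂_; _⊆_; _-_; _∩_; ⋃; ∣_∣; inside; outside; Nonempty; Empty)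
open import Data.Fin.Subset.Properties
  using ( _∈?_; nonempty?; ∉⊥; p─⊥≡p; p─q⊆p; x∈p⇒p-x⊂p; x∈p∧x≢y⇒x∈p-y
        ; x∈p∩q⁺; x∈p∩q⁻; x∈p∪q⁺; x∈p∪q⁻)
import Data.Integer as ℤ
import Data.Integer.Properties as ℤ
open import Data.Nat.Coprimality using (1-coprimeTo) renaming (sym to coprime-sym)
open import Data.Rational using (_+_)
open import Data.Rational.Properties
  using (normalize-coprime; /-cong; +-identityˡ; +-identityʳ; +-assoc; *-zeroˡ; *-zeroʳ; *-distribˡ-+; *-1-commutativeMonoid)
open import Data.Rational.Solver using (module +-*-Solver)
open import Algebra.Bundles using (CommutativeMonoid)
open import Algebra.Properties.Semiring.Sum ℕ.+-*-semiring
  using (sum; sum-syntax; sum-remove; sum-cong-≗; sum-replicate-zero; ∑-comm; *-distribˡ-sum; *-distribʳ-sum)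
open import Algebra.Properties.CommutativeSemigroup ℕ.+-commutativeSemigroup
  using () renaming (x∙yz≈y∙xz to +-exchange)
open import Algebra.Properties.CommutativeSemigroup (CommutativeMonoid.commutativeSemigroup *-1-commutativeMonoid)
  using (interchange) renaming (x∙yz≈y∙xz to *-exchange)
open import Relation.Nullary using (Dec; yes; no; does; ¬_; contradiction)
import Relation.Nullary.Decidable as Dec
open import Relation.Nullary.Decidable using (_×-dec_; ¬?; does-⇔; dec-true; dec-false)
open import Relation.Unary using (Decidable)
open import Relation.Binary.Definitions using (DecidableEquality)
open import Relation.Binary.PropositionalEquality
  using (_≢_; refl; sym; trans; cong; cong₂; subst; module ≡-Reasoning)

private
  variable
    a : Level
    A B : Set a
    n : ℕ

-- Indicators and finite sums

_≟_ : ∀ {v} → DecidableEquality (Maybe (Fin v))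
_≟_ = ≡-dec _≟ᶠ_

𝟙 : Dec A → ℕ
𝟙 a? = if does a? then 1 else 0

𝟙-⇔ : A ⇔ B → (a? : Dec A) (b? : Dec B) → 𝟙 a? ≡ 𝟙 b?
𝟙-⇔ A⇔B a? b? = cong (λ β → if β then 1 else 0) (does-⇔ A⇔B a? b?)

𝟙-yes : (a? : Dec A) → A → 𝟙 a? ≡ 1
𝟙-yes a? a = cong (λ β → if β then 1 else 0) (dec-true a? a)

𝟙-no : (a? : Dec A) → ¬ A → 𝟙 a? ≡ 0
𝟙-no a? ¬a = cong (λ β → if β then 1 else 0) (dec-false a? ¬a)

𝟙-×-dec : (a? : Dec A) (b? : Dec B) → 𝟙 (a? ×-dec b?) ≡ 𝟙 a? ℕ.* 𝟙 b?
𝟙-×-dec a? b? with does a? | does b?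
... | true  | true  = refl
... | true  | false = refl
... | false | _     = refl

∑-𝟙-∃! : {P : Fin n → Set a} (P? : Decidable P) → ∃! _≡_ P → ∑[ j < n ] 𝟙 (P? j) ≡ 1
∑-𝟙-∃! {n = ℕ.suc n} P? (j₀ , Pj₀ , unique) = begin
  ∑[ j < ℕ.suc n ] 𝟙 (P? j)
    ≡⟨ sum-remove {i = j₀} (λ j → 𝟙 (P? j)) ⟩
  𝟙 (P? j₀) ℕ.+ ∑[ j < n ] 𝟙 (P? (punchIn j₀ j))
    ≡⟨ cong₂ ℕ._+_ (𝟙-yes (P? j₀) Pj₀) (trans (sum-cong-≗ off) (sum-replicate-zero n)) ⟩
  1 ∎
  where
  open ≡-Reasoning
  off : ∀ j → 𝟙 (P? (punchIn j₀ j)) ≡ 0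
  off j = 𝟙-no (P? (punchIn j₀ j)) (λ P → punchInᵢ≢i j₀ j (sym (unique P)))

∑-const-1 : ∀ n → ∑[ j < n ] 1 ≡ n
∑-const-1 ℕ.zero    = refl
∑-const-1 (ℕ.suc n) = cong ℕ.suc (∑-const-1 n)

∑-cong-except : ∀ {f g : Fin n → ℕ} i → (∀ {j} → j ≢ i → f j ≡ g j) → g i ℕ.+ sum f ≡ f i ℕ.+ sum g
∑-cong-except {n = ℕ.suc n} {f} {g} i f≡g = begin
  g i ℕ.+ sum f                          ≡⟨ cong (g i ℕ.+_) (sum-remove {i = i} f) ⟩
  g i ℕ.+ (f i ℕ.+ sum (f ∘ punchIn i))  ≡⟨ +-exchange (g i) (f i) _ ⟩
  f i ℕ.+ (g i ℕ.+ sum (f ∘ punchIn i))  ≡⟨ cong (λ s → f i ℕ.+ (g i ℕ.+ s)) (sum-cong-≗ (f≡g ∘ punchInᵢ≢i i))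
                                          ⟩
  f i ℕ.+ (g i ℕ.+ sum (g ∘ punchIn i))  ≡⟨ cong (f i ℕ.+_) (sum-remove {i = i} g) ⟨
  f i ℕ.+ sum g                          ∎
  where open ≡-Reasoning

∑-ones-except : ∀ {f : Fin n → ℕ} i → (∀ {j} → j ≢ i → f j ≡ 1) → sum f ≡ f i ℕ.+ (n ∸ 1)
∑-ones-except {n = ℕ.suc n} {f} i f≡1 =
  trans (sum-remove {i = i} f) (cong (f i ℕ.+_) (trans (sum-cong-≗ (f≡1 ∘ punchInᵢ≢i i)) (∑-const-1 n)))

∣p∣≡∑𝟙∈ : ∀ (p : Subset n) → ∣ p ∣ ≡ ∑[ x < n ] 𝟙 (x ∈? p)
∣p∣≡∑𝟙∈ []            = refl
∣p∣≡∑𝟙∈ (outside ∷ p) = ∣p∣≡∑𝟙∈ p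
∣p∣≡∑𝟙∈ (inside  ∷ p) = cong ℕ.suc (∣p∣≡∑𝟙∈ p)

x∉p-x : ∀ {x : Fin n} (p : Subset n) → x ∉ p - x
x∉p-x {x = zero}  (s ∷ p) ()
x∉p-x {x = suc x} (s ∷ p) (there x∈p-x) = x∉p-x p x∈p-x

-- Rational sums and products over subsets

fromℕ : ℕ → ℚ
fromℕ m = + m / 1

fromℕ-suc : ∀ m → fromℕ (ℕ.suc m) ≡ 1ℚ + fromℕ m
fromℕ-suc m = sym (trans (cong (λ q → 1ℚ + q) (normalize-coprime (coprime-sym (1-coprimeTo m))))
                         (/-cong (cong (ℤ._+_ (+ 1)) (ℤ.*-identityʳ (+ m))) refl))

powℚ-distrib-* : ∀ x y m → powℚ (x * y) m ≡ powℚ x m * powℚ y m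
powℚ-distrib-* x y ℕ.zero    = refl
powℚ-distrib-* x y (ℕ.suc m) = trans (cong (λ q → x * y * q) (powℚ-distrib-* x y m))
                                      (interchange x y (powℚ x m) (powℚ y m))

sumℚ-++ : ∀ xs ys → sumℚ (xs ++ ys) ≡ sumℚ xs + sumℚ ys
sumℚ-++ []       ys = sym (+-identityˡ (sumℚ ys))
sumℚ-++ (x ∷ xs) ys = trans (cong (λ q → x + q) (sumℚ-++ xs ys)) (sym (+-assoc x (sumℚ xs) (sumℚ ys)))

sumℚ-map-zero : {f : A → ℚ} → (∀ a → f a ≡ 0ℚ) → ∀ as → sumℚ (map f as) ≡ 0ℚ
sumℚ-map-zero f≡0 []       = refl
sumℚ-map-zero f≡0 (a ∷ as) = trans (cong₂ _+_ (f≡0 a) (sumℚ-map-zero f≡0 as)) (+-identityˡ 0ℚ)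

sumℚ-map-*ˡ : ∀ q {f g : A → ℚ} → (∀ a → f a ≡ q * g a) →
              ∀ as → sumℚ (map f as) ≡ q * sumℚ (map g as)
sumℚ-map-*ˡ q f≡qg []       = sym (*-zeroʳ q)
sumℚ-map-*ˡ q f≡qg (a ∷ as) =
  trans (cong₂ _+_ (f≡qg a) (sumℚ-map-*ˡ q f≡qg as)) (sym (*-distribˡ-+ q _ _))

sumℚ-allSubsets-suc : ∀ n (f : Subset (ℕ.suc n) → ℚ) →
  sumℚ (map f (allSubsets (ℕ.suc n)))
    ≡ sumℚ (map (f ∘ (outside ∷_)) (allSubsets n)) + sumℚ (map (f ∘ (inside ∷_)) (allSubsets n))
sumℚ-allSubsets-suc n f = begin
  sumℚ (map f (map (outside ∷_) 𝒮 ++ map (inside ∷_) 𝒮))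
    ≡⟨ cong sumℚ (map-++ f (map (outside ∷_) 𝒮) (map (inside ∷_) 𝒮)) ⟩
  sumℚ (map f (map (outside ∷_) 𝒮) ++ map f (map (inside ∷_) 𝒮))
    ≡⟨ sumℚ-++ (map f (map (outside ∷_) 𝒮)) (map f (map (inside ∷_) 𝒮)) ⟩
  sumℚ (map f (map (outside ∷_) 𝒮)) + sumℚ (map f (map (inside ∷_) 𝒮))
    ≡⟨ cong₂ (λ xs ys → sumℚ xs + sumℚ ys) (sym (map-∘ 𝒮)) (sym (map-∘ 𝒮)) ⟩
  sumℚ (map (f ∘ (outside ∷_)) 𝒮) + sumℚ (map (f ∘ (inside ∷_)) 𝒮) ∎
  where
  open ≡-Reasoning
  𝒮 = allSubsets n

∏ : Subset n → (Fin n → ℚ) → ℚ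
∏ []            f = 1ℚ
∏ (outside ∷ p) f = ∏ p (f ∘ suc)
∏ (inside  ∷ p) f = f zero * ∏ p (f ∘ suc)

∏-cong : ∀ (p : Subset n) {f g} → (∀ {x} → x ∈ p → f x ≡ g x) → ∏ p f ≡ ∏ p g
∏-cong []            f≡g = refl
∏-cong (outside ∷ p) f≡g = ∏-cong p (f≡g ∘ there)
∏-cong (inside  ∷ p) f≡g = cong₂ _*_ (f≡g here) (∏-cong p (f≡g ∘ there))

∏-remove : ∀ {x} (p : Subset n) f → x ∈ p → ∏ p f ≡ f x * ∏ (p - x) f
∏-remove (inside ∷ p) f here = cong (λ q → f zero * ∏ q (f ∘ suc)) (sym (p─⊥≡p p))
∏-remove (outside ∷ p) f (there x∈p) = ∏-remove p (f ∘ suc) x∈p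
∏-remove {x = suc x} (inside ∷ p) f (there x∈p) =
  trans (cong (f zero *_) (∏-remove p (f ∘ suc) x∈p)) (*-exchange (f zero) (f (suc x)) _)

∏-zero : ∀ {x} (p : Subset n) f → x ∈ p → f x ≡ 0ℚ → ∏ p f ≡ 0ℚ
∏-zero {x = x} p f x∈p fx≡0 =
  trans (∏-remove p f x∈p) (trans (cong (_* ∏ (p - x) f) fx≡0) (*-zeroˡ (∏ (p - x) f)))

∏-empty : ∀ (p : Subset n) f → Empty p → ∏ p f ≡ 1ℚ
∏-empty []            f ∅ = refl
∏-empty (outside ∷ p) f ∅ = ∏-empty p (f ∘ suc) (λ (x , x∈p) → ∅ (suc x , there x∈p))
∏-empty (inside  ∷ p) f ∅ = contradiction (zero , here) ∅

∏-const : ∀ (p : Subset n) {f q} → (∀ {x} → x ∈ p → f x ≡ q) → ∏ p f ≡ powℚ q ∣ p ∣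
∏-const []            f≡q = refl
∏-const (outside ∷ p) f≡q = ∏-const p (f≡q ∘ there)
∏-const (inside  ∷ p) f≡q = cong₂ _*_ (f≡q here) (∏-const p (f≡q ∘ there))

-- Transversals of a partial map

record IsTransversal {n v} (c : Fin n → Maybe (Fin v)) (N : Subset v) (S : Subset n) : Set where
  field
    into      : ∀ {j} → j ∈ S → ∃[ x ] (c j ≡ just x × x ∈ N)
    onto      : ∀ {x} → x ∈ N → ∃[ j ] (j ∈ S × c j ≡ just x)
    injective : ∀ {j j′} → j ∈ S → j′ ∈ S → c j ≡ c j′ → j ≡ j′

module _ {v : ℕ} {N : Subset v} where

  transversal-[]⇔ : {c : Fin 0 → Maybe (Fin v)} → IsTransversal c N [] ⇔ Empty N
  transversal-[]⇔ = mk⇔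
    (λ T (x , x∈N) → case IsTransversal.onto T x∈N of λ ())
    (λ ∅ → record { into = λ (); onto = λ x∈N → contradiction (_ , x∈N) ∅; injective = λ () })

  transversal-outside⇔ : {c : Fin (ℕ.suc n) → Maybe (Fin v)} {S : Subset n} →
                         IsTransversal c N (outside ∷ S) ⇔ IsTransversal (c ∘ suc) N S
  transversal-outside⇔ {c = c} {S = S} = mk⇔ to from
    where
    to : IsTransversal c N (outside ∷ S) → IsTransversal (c ∘ suc) N S
    to T = record
      { into      = into ∘ there
      ; onto      = λ x∈N → case onto x∈N of λ where
                      (zero , () , _)
                      (suc j , there j∈S , cj≡x) → j , j∈S , cj≡x
      ; injective = λ j∈S j′∈S eq → suc-injective (injective (there j∈S) (there j′∈S) eq)
      }
      where open IsTransversal T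

    from : IsTransversal (c ∘ suc) N S → IsTransversal c N (outside ∷ S)
    from T = record { into = into′ ; onto = Σ.map suc (Σ.map₁ there) ∘ onto ; injective = injective′ }
      where
      open IsTransversal T
      into′ : ∀ {j} → j ∈ outside ∷ S → ∃[ x ] (c j ≡ just x × x ∈ N)
      into′ (there j∈S) = into j∈S
      injective′ : ∀ {j j′} → j ∈ outside ∷ S → j′ ∈ outside ∷ S → c j ≡ c j′ → j ≡ j′
      injective′ (there j∈S) (there j′∈S) eq = cong suc (injective j∈S j′∈S eq)

  ¬transversal-inside : {c : Fin (ℕ.suc n) → Maybe (Fin v)} {S : Subset n} →
                        (∀ {x} → c zero ≡ just x → x ∉ N) → ¬ IsTransversal c N (inside ∷ S)
  ¬transversal-inside c₀∉N T = let (x , c₀≡x , x∈N) = IsTransversal.into T here in c₀∉N c₀≡x x∈N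

  transversal-inside⇔ : {c : Fin (ℕ.suc n) → Maybe (Fin v)} {S : Subset n} {x : Fin v} → c zero ≡ just x →
                        IsTransversal c N (inside ∷ S) ⇔ (x ∈ N × IsTransversal (c ∘ suc) (N - x) S)
  transversal-inside⇔ {c = c} {S = S} {x = x} c₀≡x = mk⇔ to from
    where
    c₀≡just⇒≡x : ∀ {y} → c zero ≡ just y → y ≡ x
    c₀≡just⇒≡x c₀≡y = just-injective (trans (sym c₀≡y) c₀≡x)

    to : IsTransversal c N (inside ∷ S) → x ∈ N × IsTransversal (c ∘ suc) (N - x) S
    to T = x∈N , record
      { into      = λ j∈S → let (y , cj≡y , y∈N) = into (there j∈S) in
                    y , cj≡y , x∈p∧x≢y⇒x∈p-y y∈N λ where
                      refl → case injective (there j∈S) here (trans cj≡y (sym c₀≡x)) of λ ()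
      ; onto      = λ {y} y∈N-x → case onto (p─q⊆p N _ y∈N-x) of λ where
                      (zero , _ , c₀≡y) →
                        contradiction (subst (_∈ N - x) (c₀≡just⇒≡x c₀≡y) y∈N-x) (x∉p-x N)
                      (suc j , there j∈S , cj≡y) → j , j∈S , cj≡y
      ; injective = λ j∈S j′∈S eq → suc-injective (injective (there j∈S) (there j′∈S) eq)
      }
      where
      open IsTransversal T
      x∈N : x ∈ N
      x∈N = let (y , c₀≡y , y∈N) = into here in subst (_∈ N) (c₀≡just⇒≡x c₀≡y) y∈N

    from : x ∈ N × IsTransversal (c ∘ suc) (N - x) S → IsTransversal c N (inside ∷ S)
    from (x∈N , T) = record
      { into      = λ where
                      here        → x , c₀≡x , x∈N
                      (there j∈S) → Σ.map₂ (Σ.map₂ (p─q⊆p N _)) (into j∈S)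
      ; onto      = λ {y} y∈N → case y ≟ᶠ x of λ where
                      (yes refl) → zero , here , c₀≡x
                      (no y≢x)   → Σ.map suc (Σ.map₁ there) (onto (x∈p∧x≢y⇒x∈p-y y∈N y≢x))
      ; injective = λ where
                      here        here         _  → refl
                      here        (there j′∈S) eq → contradiction (trans (sym eq) c₀≡x) (tail≢x j′∈S)
                      (there j∈S) here         eq → contradiction (trans eq c₀≡x) (tail≢x j∈S)
                      (there j∈S) (there j′∈S) eq → cong suc (injective j∈S j′∈S eq)
      }
      where
      open IsTransversal T
      tail≢x : ∀ {j} → j ∈ S → c (suc j) ≢ just x
      tail≢x j∈S cj≡x = let (y , cj≡y , y∈N-x) = into j∈S in
        x∉p-x N (subst (_∈ N - x) (just-injective (trans (sym cj≡y) cj≡x)) y∈N-x)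

transversal? : ∀ {n v} (c : Fin n → Maybe (Fin v)) N S → Dec (IsTransversal c N S)
transversal? c N []            = Dec.map (⇔-sym transversal-[]⇔) (¬? (nonempty? N))
transversal? c N (outside ∷ S) = Dec.map (⇔-sym transversal-outside⇔) (transversal? (c ∘ suc) N S)
transversal? c N (inside  ∷ S) with c zero in c₀≡
... | nothing = no (¬transversal-inside λ c₀≡x → contradiction (trans (sym c₀≡) c₀≡x) λ ())
... | just x  = Dec.map (⇔-sym (transversal-inside⇔ c₀≡)) (x ∈? N ×-dec transversal? (c ∘ suc) (N - x) S)

fibreSize : ∀ {n v} → (Fin n → Maybe (Fin v)) → Fin v → ℕ
fibreSize {n} c x = ∑[ j < n ] 𝟙 (c j ≟ just x)

module _ {n v : ℕ} {c : Fin (ℕ.suc n) → Maybe (Fin v)} {x : Fin v} where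

  fibreSize-head-≡ : c zero ≡ just x → fibreSize c x ≡ ℕ.suc (fibreSize (c ∘ suc) x)
  fibreSize-head-≡ c₀≡x = cong (ℕ._+ fibreSize (c ∘ suc) x) (𝟙-yes (c zero ≟ just x) c₀≡x)

  fibreSize-head-≢ : c zero ≢ just x → fibreSize c x ≡ fibreSize (c ∘ suc) x
  fibreSize-head-≢ c₀≢x = cong (ℕ._+ fibreSize (c ∘ suc) x) (𝟙-no (c zero ≟ just x) c₀≢x)

module _ (p : ℚ) where

  weight : ∀ {n v} → (Fin n → Maybe (Fin v)) → Subset v → Subset n → ℚ
  weight c N S = if does (transversal? c N S) then powℚ p ∣ S ∣ else 0ℚ

  module _ {n v} {c : Fin n → Maybe (Fin v)} {N : Subset v} {S : Subset n} where

    weight-yes : IsTransversal c N S → weight c N S ≡ powℚ p ∣ S ∣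
    weight-yes T = cong (λ β → if β then powℚ p ∣ S ∣ else 0ℚ) (dec-true (transversal? c N S) T)

    weight-no : ¬ IsTransversal c N S → weight c N S ≡ 0ℚ
    weight-no ¬T = cong (λ β → if β then powℚ p ∣ S ∣ else 0ℚ) (dec-false (transversal? c N S) ¬T)

  weight-inside : ∀ {n v} {c : Fin (ℕ.suc n) → Maybe (Fin v)} {N S x} → c zero ≡ just x → x ∈ N →
                  weight c N (inside ∷ S) ≡ p * weight (c ∘ suc) (N - x) S
  weight-inside {c = c} {N} {S} {x} c₀≡x x∈N = begin
    (if does (transversal? c N (inside ∷ S)) then p * q else 0ℚ)
      ≡⟨ cong (λ β → if β then p * q else 0ℚ)
              (does-⇔ (transversal-inside⇔ {c = c} c₀≡x) (transversal? c N (inside ∷ S)) (x ∈? N ×-dec T?)) ⟩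
    (if does (x ∈? N) ∧ does T? then p * q else 0ℚ)
      ≡⟨ cong (λ β → if β ∧ does T? then p * q else 0ℚ) (dec-true (x ∈? N) x∈N) ⟩
    (if does T? then p * q else 0ℚ)
      ≡⟨ if-*ˡ (does T?) ⟩
    p * (if does T? then q else 0ℚ) ∎
    where
    open ≡-Reasoning
    q = powℚ p ∣ S ∣
    T? = transversal? (c ∘ suc) (N - x) S
    if-*ˡ : ∀ b → (if b then p * q else 0ℚ) ≡ p * (if b then q else 0ℚ)
    if-*ˡ true  = refl
    if-*ˡ false = sym (*-zeroʳ p)

  -- If player zero is in S it is the only player of S over its point x₀ = c zero, and S minus it
  -- is a transversal of c ∘ suc over N - x₀. On the right, player zero is counted only in the
  -- factor at x₀.
  ∑-weight : ∀ {v} n (c : Fin n → Maybe (Fin v)) N →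
             sumℚ (map (weight c N) (allSubsets n)) ≡ ∏ N (λ x → fromℕ (fibreSize c x) * p)
  ∑-weight ℕ.zero c N = trans (+-identityʳ (weight c N [])) (base (nonempty? N))
    where
    base : Dec (Nonempty N) → weight c N [] ≡ ∏ N (λ x → fromℕ (fibreSize c x) * p)
    base (yes (x , x∈N)) = trans (weight-no {c = c} (λ T → Equivalence.to transversal-[]⇔ T (x , x∈N)))
                                 (sym (∏-zero N _ x∈N (*-zeroˡ p)))
    base (no ∅)          = trans (weight-yes {c = c} (Equivalence.from transversal-[]⇔ ∅)) (sym (∏-empty N _ ∅))
  ∑-weight {v} (ℕ.suc n) c N = begin
    sumℚ (map (weight c N) (allSubsets (ℕ.suc n)))
      ≡⟨ sumℚ-allSubsets-suc n (weight c N) ⟩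
    sumℚ (map (weight c′ N) 𝒮) + sumℚ (map (weight c N ∘ (inside ∷_)) 𝒮)
      ≡⟨ cong (_+ sumℚ (map (weight c N ∘ (inside ∷_)) 𝒮)) (∑-weight n c′ N) ⟩
    ∏ N (factor c′) + sumℚ (map (weight c N ∘ (inside ∷_)) 𝒮)
      ≡⟨ split-head refl ⟩
    ∏ N (factor c) ∎
    where
    open ≡-Reasoning
    𝒮  = allSubsets n
    c′ = c ∘ suc

    factor : ∀ {m} → (Fin m → Maybe (Fin v)) → Fin v → ℚ
    factor d x = fromℕ (fibreSize d x) * p

    head-outside : (∀ {x} → c zero ≡ just x → x ∉ N) →
                   ∏ N (factor c′) + sumℚ (map (weight c N ∘ (inside ∷_)) 𝒮) ≡ ∏ N (factor c)
    head-outside c₀∉N = trans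
      (cong₂ _+_ (∏-cong N λ y∈N → cong (λ s → fromℕ s * p)
                                         (sym (fibreSize-head-≢ {c = c} λ c₀≡y → c₀∉N c₀≡y y∈N)))
                 (sumℚ-map-zero (λ S → weight-no {c = c} {S = inside ∷ S} (¬transversal-inside c₀∉N)) 𝒮))
      (+-identityʳ (∏ N (factor c)))

    head-inside : ∀ {x} → c zero ≡ just x → x ∈ N →
                  ∏ N (factor c′) + sumℚ (map (weight c N ∘ (inside ∷_)) 𝒮) ≡ ∏ N (factor c)
    head-inside {x} c₀≡x x∈N = begin
      ∏ N (factor c′) + sumℚ (map (weight c N ∘ (inside ∷_)) 𝒮)
        ≡⟨ cong₂ _+_ (∏-remove N (factor c′) x∈N)
                     (sumℚ-map-*ˡ p (λ S → weight-inside {c = c} {S = S} c₀≡x x∈N) 𝒮) ⟩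
      factor c′ x * ∏ (N - x) (factor c′) + p * sumℚ (map (weight c′ (N - x)) 𝒮)
        ≡⟨ cong (λ q → factor c′ x * ∏ (N - x) (factor c′) + p * q) (∑-weight n c′ (N - x)) ⟩
      fromℕ m * p * ∏ (N - x) (factor c′) + p * ∏ (N - x) (factor c′)
        ≡⟨ shift (fromℕ m) p (∏ (N - x) (factor c′)) ⟩
      (1ℚ + fromℕ m) * p * ∏ (N - x) (factor c′)
        ≡⟨ cong₂ (λ a P → a * p * P) (sym (trans (cong fromℕ (fibreSize-head-≡ {c = c} c₀≡x)) (fromℕ-suc m)))
                 (∏-cong (N - x) λ y∈N-x → cong (λ s → fromℕ s * p)
                                                 (sym (fibreSize-head-≢ {c = c} (c₀∉N-x y∈N-x)))) ⟩
      factor c x * ∏ (N - x) (factor c)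
        ≡⟨ sym (∏-remove N (factor c) x∈N) ⟩
      ∏ N (factor c) ∎
      where
      m = fibreSize c′ x
      c₀∉N-x : ∀ {y} → y ∈ N - x → c zero ≢ just y
      c₀∉N-x y∈N-x c₀≡y = x∉p-x N (subst (_∈ N - x) (just-injective (trans (sym c₀≡y) c₀≡x)) y∈N-x)
      shift : ∀ a q r → a * q * r + q * r ≡ (1ℚ + a) * q * r
      shift = solve 3 (λ a q r → a :* q :* r :+ q :* r := (con 1ℚ :+ a) :* q :* r) refl
        where open +-*-Solver

    split-head : ∀ {m} → c zero ≡ m →
                 ∏ N (factor c′) + sumℚ (map (weight c N ∘ (inside ∷_)) 𝒮) ≡ ∏ N (factor c)
    split-head {nothing} c₀≡ = head-outside λ c₀≡x → contradiction (trans (sym c₀≡) c₀≡x) λ ()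
    split-head {just x}  c₀≡ with x ∈? N
    ... | yes x∈N = head-inside c₀≡ x∈N
    ... | no  x∉N = head-outside λ c₀≡y → subst (_∉ N) (just-injective (trans (sym c₀≡) c₀≡y)) x∉N

-- Designs and repair sets

coverOf-tail : ∀ {v b} (B : Fin (ℕ.suc b) → Subset v) S →
               ⋃ (map B (map suc (members S))) ≡ coverOf (B ∘ suc) S
coverOf-tail B S = cong ⋃ (sym (map-∘ (members S)))

∈-coverOf⁺ : ∀ {v b} (B : Fin b → Subset v) {S j x} → j ∈ S → x ∈ B j → x ∈ coverOf B S
∈-coverOf⁺ B {outside ∷ S} {suc j} {x} (there j∈S) x∈Bj =
  subst (x ∈_) (sym (coverOf-tail B S)) (∈-coverOf⁺ (B ∘ suc) j∈S x∈Bj)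
∈-coverOf⁺ B {inside ∷ S} {zero} here x∈B0 = x∈p∪q⁺ (inj₁ x∈B0)
∈-coverOf⁺ B {inside ∷ S} {suc j} {x} (there j∈S) x∈Bj =
  x∈p∪q⁺ (inj₂ (subst (x ∈_) (sym (coverOf-tail B S)) (∈-coverOf⁺ (B ∘ suc) j∈S x∈Bj)))

∈-coverOf⁻ : ∀ {v b} (B : Fin b → Subset v) S {x} → x ∈ coverOf B S → ∃[ j ] (j ∈ S × x ∈ B j)
∈-coverOf⁻ B []            x∈ = contradiction x∈ ∉⊥
∈-coverOf⁻ B (outside ∷ S) {x} x∈ =
  Σ.map suc (Σ.map₁ there) (∈-coverOf⁻ (B ∘ suc) S (subst (x ∈_) (coverOf-tail B S) x∈))
∈-coverOf⁻ B (inside ∷ S) {x} x∈ with x∈p∪q⁻ (B zero) _ x∈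
... | inj₁ x∈B0   = zero , here , x∈B0
... | inj₂ x∈rest =
  Σ.map suc (Σ.map₁ there) (∈-coverOf⁻ (B ∘ suc) S (subst (x ∈_) (coverOf-tail B S) x∈rest))

degree : ∀ {v b} → (Fin b → Subset v) → Fin v → ℕ
degree {b = b} B x = ∑[ j < b ] 𝟙 (x ∈? B j)

module BIBD {v k b} {B : Fin b → Subset v} (bibd : IsBIBD v k b B) where
  open IsBIBD bibd

  commonBlocks : Fin v → Fin v → ℕ
  commonBlocks x y = ∑[ j < b ] 𝟙 (x ∈? B j ×-dec y ∈? B j)

  degree*k≡∑commonBlocks : ∀ x → degree B x ℕ.* k ≡ ∑[ y < v ] commonBlocks x y
  degree*k≡∑commonBlocks x = begin
    degree B x ℕ.* k
      ≡⟨ *-distribʳ-sum k (λ j → 𝟙 (x ∈? B j)) ⟩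
    ∑[ j < b ] (𝟙 (x ∈? B j) ℕ.* k)
      ≡⟨ sum-cong-≗ (λ j → cong (𝟙 (x ∈? B j) ℕ.*_) (trans (sym (blockSize j)) (∣p∣≡∑𝟙∈ (B j)))) ⟩
    ∑[ j < b ] (𝟙 (x ∈? B j) ℕ.* ∑[ y < v ] 𝟙 (y ∈? B j))
      ≡⟨ sum-cong-≗ (λ j → *-distribˡ-sum (𝟙 (x ∈? B j)) (λ y → 𝟙 (y ∈? B j))) ⟩
    ∑[ j < b ] ∑[ y < v ] (𝟙 (x ∈? B j) ℕ.* 𝟙 (y ∈? B j))
      ≡⟨ ∑-comm (λ j y → 𝟙 (x ∈? B j) ℕ.* 𝟙 (y ∈? B j)) ⟩
    ∑[ y < v ] ∑[ j < b ] (𝟙 (x ∈? B j) ℕ.* 𝟙 (y ∈? B j))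
      ≡⟨ sum-cong-≗ (λ y → sum-cong-≗ (λ j → sym (𝟙-×-dec (x ∈? B j) (y ∈? B j)))) ⟩
    ∑[ y < v ] commonBlocks x y ∎
    where open ≡-Reasoning

  ∑commonBlocks≡degree+[v∸1] : ∀ x → ∑[ y < v ] commonBlocks x y ≡ degree B x ℕ.+ (v ∸ 1)
  ∑commonBlocks≡degree+[v∸1] x = trans
    (∑-ones-except x λ y≢x → ∑-𝟙-∃! (λ j → x ∈? B j ×-dec _ ∈? B j) (pairUnique x _ (y≢x ∘ sym)))
    (cong (ℕ._+ (v ∸ 1)) commonBlocks-diagonal)
    where
    commonBlocks-diagonal : commonBlocks x x ≡ degree B x
    commonBlocks-diagonal = sum-cong-≗ λ j →
      𝟙-⇔ (mk⇔ Σ.proj₁ λ x∈Bj → x∈Bj , x∈Bj) (x ∈? B j ×-dec x ∈? B j) (x ∈? B j)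

  degree*[k∸1]≡v∸1 : ∀ x → degree B x ℕ.* (k ∸ 1) ≡ v ∸ 1
  degree*[k∸1]≡v∸1 x = begin
    d ℕ.* (k ∸ 1)
      ≡⟨ ℕ.*-distribˡ-∸ d k 1 ⟩
    d ℕ.* k ∸ d ℕ.* 1
      ≡⟨ cong₂ _∸_ (trans (degree*k≡∑commonBlocks x) (∑commonBlocks≡degree+[v∸1] x)) (ℕ.*-identityʳ d) ⟩
    d ℕ.+ (v ∸ 1) ∸ d
      ≡⟨ ℕ.m+n∸m≡n d (v ∸ 1) ⟩
    v ∸ 1 ∎
    where
    open ≡-Reasoning
    d = degree B x

  degree≡replication : ∀ r → r ℕ.* (k ∸ 1) ≡ v ∸ 1 → ∀ x → degree B x ≡ r
  degree≡replication r r*[k∸1]≡v∸1 x =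
    ℕ.*-cancelʳ-≡ (degree B x) r (k ∸ 1) {{ℕ.>-nonZero (ℕ.∸-monoˡ-≤ 1 two≤k)}}
      (trans (degree*[k∸1]≡v∸1 x) (sym r*[k∸1]≡v∸1))

  blocks-meet-at-most-once : ∀ {j j′ x y} → j ≢ j′ →
                             x ∈ B j → x ∈ B j′ → y ∈ B j → y ∈ B j′ → x ≡ y
  blocks-meet-at-most-once {x = x} {y = y} j≢j′ x∈Bj x∈Bj′ y∈Bj y∈Bj′ with x ≟ᶠ y
  ... | yes x≡y = x≡y
  ... | no  x≢y = let (_ , _ , unique) = pairUnique x y x≢y in
                  contradiction (trans (sym (unique (x∈Bj , y∈Bj))) (unique (x∈Bj′ , y∈Bj′))) j≢j′

  module Player (i : Fin b) where

    contact : Fin b → Maybe (Fin v)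
    contact j with j ≟ᶠ i | nonempty? (B j ∩ B i)
    ... | yes _ | _           = nothing
    ... | no  _ | yes (x , _) = just x
    ... | no  _ | no  _       = nothing

    contact≡just⇔ : ∀ {j x} → contact j ≡ just x ⇔ (j ≢ i × x ∈ B j × x ∈ B i)
    contact≡just⇔ {j} {x} with j ≟ᶠ i | nonempty? (B j ∩ B i)
    ... | yes j≡i | _ = mk⇔ (λ ()) λ (j≢i , _) → contradiction j≡i j≢i
    ... | no  j≢i | yes (y , y∈Bj∩Bi) = mk⇔
      (λ where refl → j≢i , x∈p∩q⁻ (B j) (B i) y∈Bj∩Bi)
      (λ (_ , x∈Bj , x∈Bi) → let (y∈Bj , y∈Bi) = x∈p∩q⁻ (B j) (B i) y∈Bj∩Bi in
                              cong just (blocks-meet-at-most-once j≢i y∈Bj y∈Bi x∈Bj x∈Bi))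
    ... | no  j≢i | no  ∅ = mk⇔ (λ ()) λ (_ , x∈Bj , x∈Bi) → contradiction (x , x∈p∩q⁺ (x∈Bj , x∈Bi)) ∅

    fibreSize-contact : ∀ r {x} → r ℕ.* (k ∸ 1) ≡ v ∸ 1 → x ∈ B i → fibreSize contact x ≡ r ∸ 1
    fibreSize-contact r {x} r*[k∸1]≡v∸1 x∈Bi = begin
      fibreSize contact x
        ≡⟨⟩
      ℕ.suc (fibreSize contact x) ∸ 1
        ≡⟨ cong (λ m → m ℕ.+ fibreSize contact x ∸ 1) (𝟙-yes (x ∈? B i) x∈Bi) ⟨
      𝟙 (x ∈? B i) ℕ.+ fibreSize contact x ∸ 1
        ≡⟨ cong (_∸ 1) (∑-cong-except i contact≡just-off-i) ⟩
      𝟙 (contact i ≟ just x) ℕ.+ degree B x ∸ 1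
        ≡⟨ cong (λ m → m ℕ.+ degree B x ∸ 1) (𝟙-no (contact i ≟ just x) contact-i) ⟩
      degree B x ∸ 1
        ≡⟨ cong (_∸ 1) (degree≡replication r r*[k∸1]≡v∸1 x) ⟩
      r ∸ 1 ∎
      where
      open ≡-Reasoning
      contact-i : contact i ≢ just x
      contact-i ci≡x = Σ.proj₁ (Equivalence.to contact≡just⇔ ci≡x) refl
      contact≡just-off-i : ∀ {j} → j ≢ i → 𝟙 (contact j ≟ just x) ≡ 𝟙 (x ∈? B j)
      contact≡just-off-i {j} j≢i = 𝟙-⇔
        (mk⇔ (λ cj≡x → Σ.proj₁ (Σ.proj₂ (Equivalence.to contact≡just⇔ cj≡x)))
             (λ x∈Bj → Equivalence.from contact≡just⇔ (j≢i , x∈Bj , x∈Bi)))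
        (contact j ≟ just x) (x ∈? B j)

    repairSet⇒onto : ∀ {S} → IsRepairSet B i S → ∀ {x} → x ∈ B i → ∃[ j ] (j ∈ S × contact j ≡ just x)
    repairSet⇒onto {S} (i∉S , Bi⊆cover) x∈Bi =
      let (j , j∈S , x∈Bj) = ∈-coverOf⁻ B S (Bi⊆cover x∈Bi) in
      j , j∈S , Equivalence.from contact≡just⇔ ((λ j≡i → i∉S (subst (_∈ S) j≡i j∈S)) , x∈Bj , x∈Bi)

    onto⇒⊆coverOf : ∀ {S} → (∀ {x} → x ∈ B i → ∃[ j ] (j ∈ S × contact j ≡ just x)) → B i ⊆ coverOf B S
    onto⇒⊆coverOf onto x∈Bi =
      let (j , j∈S , cj≡x) = onto x∈Bi in
      ∈-coverOf⁺ B j∈S (Σ.proj₁ (Σ.proj₂ (Equivalence.to contact≡just⇔ cj≡x)))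

    transversal⇒minimal : ∀ {S} → IsTransversal contact (B i) S → IsMinimalRepairSet B i S
    transversal⇒minimal {S} T = (i∉S , onto⇒⊆coverOf onto) , no-smaller
      where
      open IsTransversal T
      i∉S : i ∉ S
      i∉S i∈S = let (_ , ci≡x , _) = into i∈S in Σ.proj₁ (Equivalence.to contact≡just⇔ ci≡x) refl
      no-smaller : ¬ (∃[ R ] (R ⊂ S × IsRepairSet B i R))
      no-smaller (R , (R⊆S , j₀ , j₀∈S , j₀∉R) , R-repairs) =
        let (x , cj₀≡x , x∈Bi) = into j₀∈S
            (j , j∈R , cj≡x)   = repairSet⇒onto {S = R} R-repairs x∈Bi
        in j₀∉R (subst (_∈ R) (sym (injective j₀∈S (R⊆S j∈R) (trans cj₀≡x (sym cj≡x)))) j∈R)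

    minimal⇒transversal : ∀ {S} → IsMinimalRepairSet B i S → IsTransversal contact (B i) S
    minimal⇒transversal {S} (S-repairs@(i∉S , _) , minimal) = record
      { into = into ; onto = repairSet⇒onto S-repairs ; injective = injective }
      where
      redundant : ∀ {j} → j ∈ S →
                  (∀ {x} → contact j ≡ just x → ∃[ j′ ] (j′ ≢ j × j′ ∈ S × contact j′ ≡ just x)) → ⊥
      redundant {j} j∈S replaceable =
        minimal (S - j , x∈p⇒p-x⊂p j∈S , (i∉S ∘ p─q⊆p S _ , onto⇒⊆coverOf {S = S - j} onto-S-j))
        where
        onto-S-j : ∀ {x} → x ∈ B i → ∃[ j′ ] (j′ ∈ S - j × contact j′ ≡ just x)
        onto-S-j x∈Bi with repairSet⇒onto S-repairs x∈Bi
        ... | j′ , j′∈S , cj′≡x with j′ ≟ᶠ j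
        ...   | no  j′≢j = j′ , x∈p∧x≢y⇒x∈p-y j′∈S j′≢j , cj′≡x
        ...   | yes refl = let (j″ , j″≢j , j″∈S , cj″≡x) = replaceable cj′≡x in
                           j″ , x∈p∧x≢y⇒x∈p-y j″∈S j″≢j , cj″≡x

      into : ∀ {j} → j ∈ S → ∃[ x ] (contact j ≡ just x × x ∈ B i)
      into {j} j∈S with contact j in cj≡
      ... | just x  = x , refl , Σ.proj₂ (Σ.proj₂ (Equivalence.to contact≡just⇔ cj≡))
      ... | nothing = ⊥-elim (redundant j∈S λ cj≡x → contradiction (trans (sym cj≡) cj≡x) λ ())

      injective : ∀ {j j′} → j ∈ S → j′ ∈ S → contact j ≡ contact j′ → j ≡ j′
      injective {j} {j′} j∈S j′∈S cj≡cj′ with j ≟ᶠ j′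
      ... | yes j≡j′ = j≡j′
      ... | no  j≢j′ =
        ⊥-elim (redundant j∈S λ cj≡x → j′ , j≢j′ ∘ sym , j′∈S , trans (sym cj≡cj′) cj≡x)

    minimal⇔transversal : ∀ {S} → IsMinimalRepairSet B i S ⇔ IsTransversal contact (B i) S
    minimal⇔transversal = mk⇔ minimal⇒transversal transversal⇒minimal

theorem2p2 : ∀ (v k b r : ℕ) (B : Fin b → Subset v) → IsBIBD v k b B →
    r Data.Nat.* (k ∸ 1) ≡ v ∸ 1 →
    ∀ (i : Fin b) (p : ℚ) → 0ℚ ≤ p → p ≤ 1ℚ →
    expectedAvailMinRepair B i p ≡ powℚ ((+ (r ∸ 1)) / 1) k * powℚ p k
theorem2p2 v k b r B bibd r*[k∸1]≡v∸1 i p _ _ = begin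
  expectedAvailMinRepair B i p
    ≡⟨ expected≡∑weight ⟩
  sumℚ (map (weight p contact (B i)) (allSubsets b))
    ≡⟨ ∑-weight p b contact (B i) ⟩
  ∏ (B i) (λ x → fromℕ (fibreSize contact x) * p)
    ≡⟨ ∏-const (B i) (λ x∈Bi → cong (λ m → fromℕ m * p) (fibreSize-contact r r*[k∸1]≡v∸1 x∈Bi)) ⟩
  powℚ (fromℕ (r ∸ 1) * p) ∣ B i ∣
    ≡⟨ cong (powℚ (fromℕ (r ∸ 1) * p)) (IsBIBD.blockSize bibd i) ⟩
  powℚ (fromℕ (r ∸ 1) * p) k
    ≡⟨ powℚ-distrib-* (fromℕ (r ∸ 1)) p k ⟩
  powℚ (fromℕ (r ∸ 1)) k * powℚ p k ∎
  where
  open ≡-Reasoning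
  open BIBD bibd
  open Player i
  -- The summand of expectedAvailMinRepair is local to its where-block, so the left-hand side is
  -- found by unification with expected≡∑weight, which therefore has to be checked first.
  summand≡weight : ∀ S → _ ≡ weight p contact (B i) S
  expected≡∑weight : expectedAvailMinRepair B i p ≡ sumℚ (map (weight p contact (B i)) (allSubsets b))
  expected≡∑weight = cong sumℚ (map-cong summand≡weight (allSubsets b))
  summand≡weight S with isMinimalRepairSet? B i S
  ... | yes minimal = sym (weight-yes p (Equivalence.to minimal⇔transversal minimal))
  ... | no ¬minimal = sym (weight-no p (¬minimal ∘ Equivalence.from minimal⇔transversal))
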